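{- Let $\mathcal{A}$ be a real central hyperplane arrangement with $\operatorname{rank}\mathcal{A}=r$ and $\#\mathcal{A}=n$, and suppose $\mathcal{A}$ is not Boolean, i.e. $r<n$. Then $MH^\circ_{\ell,\ell}(\mathcal{A})=0$ for all $\ell\ge0$.
   Context: An arrangement is a finite set of linear hyperplanes in $\mathbb{R}^d$; its rank is the codimension of $\bigcap\mathcal{A}$. Chambers are connected components of the complement of the union; for chambers $C,D$, $S(C,D)$ is the set of separating hyperplanes and $d(C,D)=\#S(C,D)$. $MC_{k,\ell}(\mathcal{A})$ is free abelian on proper chains $\vec x=(x_0,\ldots,x_k)$ of chambers ($x_i\ne x_{i+1}$) with $\sum d(x_{i-1},x_i)=\ell$, differential $\partial=\sum_{i=1}^{k-1}(-1)^{i-1}\partial_i$, $\partial_i$ deleting $x_i$ if $d(x_{i-1},x_{i+1})=d(x_{i-1},x_i)+d(x_i,x_{i+1})$ and $0$ otherwise. With $S(\vec x)=\bigcup_iS(x_{i-1},x_i)$, the interior magnitude complex $MC^\circ_{*,\ell}(\mathcal{A})$ is the subcomplex spanned by chains with $\bigcap S(\vec x)=\bigcap\mathcal{A}$ (where $\bigcap\varnothing=\mathbb{R}^d$), and $MH^\circ_{k,\ell}(\mathcal{A})$ is its homology. -}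

module Defs where

open import Level using (0ℓ)
open import Data.Nat as ℕ using (ℕ; zero; suc; _≡ᵇ_)
open import Data.Integer as ℤ using (ℤ; +_)
open import Data.Fin using (Fin; zero; suc)
open import Data.Bool using (Bool; true; false; if_then_else_)
import Data.Bool as Bool
open import Data.Vec using (Vec; lookup)
import Data.Vec.Properties as VecP
open import Data.List using (List; []; _∷_; _++_; reverse; length; concatMap; map)
import Data.List.Properties as ListP
open import Data.List.Relation.Unary.All using (All)
open import Data.Product using (Σ; ∃; _×_; _,_; proj₁; proj₂)
open import Data.Sum using (_⊎_)
open import Data.Empty using (⊥)
open import Relation.Nullary using (¬_; yes; no)
open import Relation.Binary.PropositionalEquality using (_≡_; _≢_)
open import Relation.Binary using (Rel; DecidableEquality)
open import Relation.Binary.Structures using (IsStrictTotalOrder)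
open import Algebra.Structures using (IsCommutativeRing)

record RealField : Set₁ where
  infixl 6 _+_
  infixl 7 _*_
  infix 4 _<_ _≤_
  field
    Carrier : Set
    _+_ _*_ : Carrier → Carrier → Carrier
    -_      : Carrier → Carrier
    0# 1#   : Carrier
    isCommutativeRing : IsCommutativeRing _≡_ _+_ _*_ -_ 0# 1#
    inverse : ∀ x → x ≢ 0# → ∃ λ y → x * y ≡ 1#
    _<_ : Rel Carrier 0ℓ
    <-isStrictTotalOrder : IsStrictTotalOrder _≡_ _<_
    0<1 : 0# < 1#
    +-mono-< : ∀ {x y} z → x < y → x + z < y + z
    *-pos : ∀ {x y} → 0# < x → 0# < y → 0# < x * y

  _≤_ : Rel Carrier 0ℓ
  x ≤ y = x < y ⊎ x ≡ y

  field
    complete : (P : Carrier → Set) → ∃ P → (∃ λ b → ∀ x → P x → x ≤ b) →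
               ∃ λ s → (∀ x → P x → x ≤ s) × (∀ b → (∀ x → P x → x ≤ b) → s ≤ b)

module _ (F : RealField) where
  open RealField F

  sumF : ∀ {m} → (Fin m → Carrier) → Carrier
  sumF {zero}  f = 0#
  sumF {suc m} f = f zero + sumF (λ i → f (suc i))

  dot : ∀ {d} → (Fin d → Carrier) → (Fin d → Carrier) → Carrier
  dot u v = sumF (λ j → u j * v j)

-- A central (linear) arrangement of n distinct hyperplanes in ℝ^d,
-- H_i = { v | normal i · v = 0 }.

record Arrangement (F : RealField) (d n : ℕ) : Set where
  open RealField F
  field
    normal   : Fin n → Fin d → Carrier
    nonzero  : ∀ i → ¬ (∀ j → normal i j ≡ 0#)
    distinct : ∀ i j → i ≢ j →
               ¬ (∃ λ c → ∀ k → normal i k ≡ c * normal j k)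

module _ {F : RealField} {d n : ℕ} (A : Arrangement F d n) where
  open RealField F
  open Arrangement A

  form : Fin n → (Fin d → Carrier) → Carrier
  form i v = dot F (normal i) v

  -- Boolean: rank A = #A, i.e. the defining forms are linearly independent.
  Boolean : Set
  Boolean = ∀ (c : Fin n → Carrier) →
            (∀ k → sumF F (λ i → c i * normal i k) ≡ 0#) → ∀ i → c i ≡ 0#

  -- Chambers are identified with their sign vectors: σ is a chamber iff the
  -- open cone { v | sign(form i v) = σ i for all i } is nonempty.
  SignVec : Set
  SignVec = Vec Bool n

  IsChamber : SignVec → Set
  IsChamber σ = ∃ λ v → ∀ i →
    (if lookup σ i then 0# < form i v else form i v < 0#)

  Sep : SignVec → SignVec → Fin n → Set
  Sep σ τ i = lookup σ i ≢ lookup τ i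

  dist : SignVec → SignVec → ℕ
  dist σ τ = go (λ i → lookup σ i) (λ i → lookup τ i)
    where
    go : ∀ {m} → (Fin m → Bool) → (Fin m → Bool) → ℕ
    go {zero}  f g = 0
    go {suc m} f g = (if Bool._xor_ (f zero) (g zero) then 1 else 0)
                     ℕ.+ go (λ i → f (suc i)) (λ i → g (suc i))

  Chain : Set
  Chain = List SignVec

  _≟C_ : DecidableEquality Chain
  _≟C_ = ListP.≡-dec (VecP.≡-dec Bool._≟_)

  Proper : Chain → Set
  Proper (a ∷ b ∷ rest) = a ≢ b × Proper (b ∷ rest)
  Proper _ = Data.Unit.⊤
    where import Data.Unit

  weight : Chain → ℕ
  weight (a ∷ b ∷ rest) = dist a b ℕ.+ weight (b ∷ rest)
  weight _ = 0

  InS : Chain → Fin n → Set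
  InS (a ∷ b ∷ rest) i = Sep a b i ⊎ InS (b ∷ rest) i
  InS _ i = ⊥

  -- ⋂ S(x⃗) = ⋂ A  (as subsets of ℝ^d; ⋂ ∅ = ℝ^d)
  Interior : Chain → Set
  Interior x = ∀ v → ((∀ i → InS x i → form i v ≡ 0#) → (∀ i → form i v ≡ 0#))
                   × ((∀ i → form i v ≡ 0#) → (∀ i → InS x i → form i v ≡ 0#))

  -- generator of MC°_{k,ℓ}: proper chain (x_0,…,x_k) of chambers, length ℓ, interior
  Gen : ℕ → ℕ → Chain → Set
  Gen k ℓ x = (length x ≡ suc k) × All IsChamber x × Proper x
            × (weight x ≡ ℓ) × Interior x

  FSum : Set
  FSum = List (ℤ × Chain)

  coeff : FSum → Chain → ℤ
  coeff [] y = + 0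
  coeff ((z , x) ∷ c) y with x ≟C y
  ... | yes _ = z ℤ.+ coeff c y
  ... | no  _ = coeff c y

  InMC : ℕ → ℕ → FSum → Set
  InMC k ℓ c = All (λ p → Gen k ℓ (proj₂ p)) c

  geodesic : SignVec → SignVec → SignVec → Bool
  geodesic a b c = dist a c ≡ᵇ (dist a b ℕ.+ dist b c)

  -- ∂ = Σ_{i=1}^{k-1} (-1)^{i-1} ∂_i on a single chain
  ∂chain : Chain → FSum
  ∂chain x = go (+ 1) [] x
    where
    go : ℤ → Chain → Chain → FSum
    go s pre (a ∷ b ∷ c ∷ rest) =
      (if geodesic a b c then (s , reverse pre ++ a ∷ c ∷ rest) ∷ [] else [])
      ++ go (ℤ.- s) (a ∷ pre) (b ∷ c ∷ rest)
    go s pre _ = []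

  ∂ : FSum → FSum
  ∂ = concatMap (λ p → map (λ q → (proj₁ p ℤ.* proj₁ q , proj₂ q)) (∂chain (proj₂ p)))

  MH°Vanishes : ℕ → ℕ → Set
  MH°Vanishes k ℓ = ∀ (c : FSum) → InMC k ℓ c → (∀ y → coeff (∂ c) y ≡ + 0) →
    ∃ λ (b : FSum) → InMC (suc k) ℓ b × (∀ y → coeff (∂ b) y ≡ coeff c y)

{-# OPTIONS --safe #-}
module Submission where

open import Defs
open import Data.Nat using (ℕ)
open import Relation.Nullary using (¬_)

open import Data.Nat as ℕ using (zero; suc; _≡ᵇ_)
import Data.Nat.Properties as ℕP
open import Data.Integer as ℤ using (ℤ; +_; -[1+_])
import Data.Integer.Properties as ℤP
open import Data.Integer.Tactic.RingSolver using (solve-∀)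
open import Data.Fin using (Fin; zero; suc)
import Data.Fin.Properties as FinP
open import Data.Bool using (Bool; true; false; not; _xor_; if_then_else_)
import Data.Bool.Properties as BoolP
open import Data.Vec using (Vec; []; _∷_; lookup; tabulate; _[_]%=_)
import Data.Vec.Properties as VecP
open import Data.List using (List; []; _∷_; _++_; length; reverse; map; foldl; deduplicate)
import Data.List.Properties as ListP
open import Data.List.Relation.Unary.All as All using (All; []; _∷_)
import Data.List.Relation.Unary.All.Properties as AllP
open import Data.List.Relation.Unary.Any using (Any; here; there)
open import Data.List.Relation.Unary.AllPairs using ([]; _∷_)
open import Data.List.Relation.Unary.Unique.Propositional using (Unique)
import Data.List.Relation.Unary.Unique.DecPropositional.Properties as UniqueP
open import Data.List.Membership.Propositional using (_∈_; _∉_)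
import Data.List.Membership.Propositional.Properties as MemP
open import Data.List.Relation.Binary.Permutation.Propositional using (_↭_; ↭-sym)
import Data.List.Relation.Binary.Permutation.Propositional.Properties as PermP
open import Data.Product as Product using (∃; ∃₂; _×_; _,_; proj₁; proj₂; map₂)
open import Data.Sum using (_⊎_; inj₁; inj₂; [_,_])
open import Function using (_∘_; _∋_)
open import Relation.Nullary using (Dec; yes; no; does; contradiction)
open import Relation.Binary.PropositionalEquality hiding ([_])
open import Relation.Binary.Definitions using (tri<; tri≈; tri>)
open import Relation.Binary.Structures using (IsStrictTotalOrder)
open import Algebra.Bundles using (CommutativeRing)
open import Algebra.Structures using (IsCommutativeRing)

-- In the diagonal every step of a generating chain crosses exactly one hyperplane, so the generators
-- are galleries (a chamber σ and the word w of crossed hyperplanes) and MC°_{ℓ+1,ℓ} = 0: we must show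
-- that a cycle c vanishes.  Dropping the vertex between two consecutive crossings of distinct
-- hyperplanes h, h′ gives a chain that is a face of exactly two galleries, the given one and the one
-- with h and h′ swapped, and with the same sign; so ∂c = 0 makes c antisymmetric under such swaps.
-- Moving letters to the front of w then shows that if c is nonzero at an interior gallery, every sign
-- vector agreeing with σ outside the set S of letters of w is a chamber.  Combining points of adjacent
-- chambers produces a point of ⋂S with the signs of σ outside S; as the gallery is interior it lies
-- in ⋂A, so S = A.  Hence all 2ⁿ sign vectors are chambers, which forces A to be Boolean.

private
  variable
    m n : ℕ

-- Sign vectors

flip : Vec Bool n → Fin n → Vec Bool n
flip σ i = σ [ i ]%= not

module _ (σ : Vec Bool n) where

  lookup-flip : ∀ i → lookup (flip σ i) i ≡ not (lookup σ i)
  lookup-flip i = VecP.lookup∘updateAt i σ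

  lookup-flip-≢ : ∀ {i j} → j ≢ i → lookup (flip σ i) j ≡ lookup σ j
  lookup-flip-≢ {i} {j} j≢i = VecP.lookup∘updateAt′ j i j≢i σ

  flip-involutive : ∀ i → flip (flip σ i) i ≡ σ
  flip-involutive i =
    trans (VecP.updateAt-updateAt-local i {h = λ b → b} σ (BoolP.not-involutive (lookup σ i))) (VecP.updateAt-id i σ)

  flip-comm : ∀ i j → flip (flip σ i) j ≡ flip (flip σ j) i
  flip-comm i j with i FinP.≟ j
  ... | yes refl = refl
  ... | no i≢j   = VecP.updateAt-commutes j i (i≢j ∘ sym) σ

  flip-injective : ∀ {i j} → flip σ i ≡ flip σ j → i ≡ j
  flip-injective {i} {j} eq with i FinP.≟ j
  ... | yes i≡j = i≡j
  ... | no i≢j  = contradiction (trans (sym (lookup-flip i)) (trans (cong (λ τ → lookup τ i) eq) (lookup-flip-≢ i≢j)))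
                                (BoolP.not-¬ refl ∘ sym)

  lookup-flip-flip : ∀ {i j} → i ≢ j → lookup (flip (flip σ i) j) i ≡ not (lookup σ i)
  lookup-flip-flip {i} {j} i≢j = trans (VecP.lookup∘updateAt′ i j i≢j (flip σ i)) (lookup-flip i)

  flip-flip-moves : ∀ {i j k} → lookup (flip (flip σ i) j) k ≢ lookup σ k → k ≡ i ⊎ k ≡ j
  flip-flip-moves {i} {j} {k} moved with k FinP.≟ i | k FinP.≟ j
  ... | yes k≡i | _        = inj₁ k≡i
  ... | no _    | yes k≡j  = inj₂ k≡j
  ... | no k≢i  | no k≢j   = contradiction (trans (VecP.lookup∘updateAt′ k j k≢j (flip σ i)) (lookup-flip-≢ k≢i)) moved

  flip-flip-injective : ∀ {g g′ h h′} → g ≢ g′ → flip (flip σ g) g′ ≡ flip (flip σ h) h′ →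
                        (g ≡ h × g′ ≡ h′) ⊎ (g ≡ h′ × g′ ≡ h)
  flip-flip-injective {g} {g′} {h} {h′} g≢g′ eq
    with flip-flip-moves (moved g≢g′ eq) | flip-flip-moves (moved (g≢g′ ∘ sym) (trans (flip-comm g′ g) eq))
    where
    moved : ∀ {i j} → i ≢ j → flip (flip σ i) j ≡ flip (flip σ h) h′ → lookup (flip (flip σ h) h′) i ≢ lookup σ i
    moved {i} i≢j eq′ same =
      BoolP.not-¬ refl (trans (sym same) (trans (cong (λ τ → lookup τ i) (sym eq′)) (lookup-flip-flip i≢j)))
  ... | inj₁ g≡h  | inj₂ g′≡h′ = inj₁ (g≡h , g′≡h′)
  ... | inj₂ g≡h′ | inj₁ g′≡h  = inj₂ (g≡h′ , g′≡h)
  ... | inj₁ g≡h  | inj₁ g′≡h  = contradiction (trans g≡h (sym g′≡h)) g≢g′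
  ... | inj₂ g≡h′ | inj₂ g′≡h′ = contradiction (trans g≡h′ (sym g′≡h′)) g≢g′

hamming : Vec Bool m → Vec Bool m → ℕ
hamming []      []      = 0
hamming (a ∷ σ) (b ∷ τ) = (if a xor b then 1 else 0) ℕ.+ hamming σ τ

xor-not : ∀ a → a xor not a ≡ true
xor-not false = refl
xor-not true  = refl

hamming-refl : (σ : Vec Bool m) → hamming σ σ ≡ 0
hamming-refl []      = refl
hamming-refl (a ∷ σ) rewrite BoolP.xor-same a = hamming-refl σ

hamming≡0⇒≡ : {σ τ : Vec Bool m} → hamming σ τ ≡ 0 → σ ≡ τ
hamming≡0⇒≡ {σ = []}        {[]}        _ = refl
hamming≡0⇒≡ {σ = false ∷ σ} {false ∷ τ} d = cong (false ∷_) (hamming≡0⇒≡ d)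
hamming≡0⇒≡ {σ = true  ∷ σ} {true  ∷ τ} d = cong (true ∷_) (hamming≡0⇒≡ d)

hamming-flip : (σ : Vec Bool m) (i : Fin m) → hamming σ (flip σ i) ≡ 1
hamming-flip (a ∷ σ) zero    rewrite xor-not a       = cong suc (hamming-refl σ)
hamming-flip (a ∷ σ) (suc i) rewrite BoolP.xor-same a = hamming-flip σ i

hamming≡1⇒flip : {σ τ : Vec Bool m} → hamming σ τ ≡ 1 → ∃ λ i → τ ≡ flip σ i
hamming≡1⇒flip {σ = []}        {[]}        ()
hamming≡1⇒flip {σ = false ∷ σ} {false ∷ τ} d = Product.map suc (cong (false ∷_)) (hamming≡1⇒flip d)
hamming≡1⇒flip {σ = false ∷ σ} {true  ∷ τ} d = zero , cong (true ∷_) (sym (hamming≡0⇒≡ (ℕP.suc-injective d)))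
hamming≡1⇒flip {σ = true  ∷ σ} {false ∷ τ} d = zero , cong (false ∷_) (sym (hamming≡0⇒≡ (ℕP.suc-injective d)))
hamming≡1⇒flip {σ = true  ∷ σ} {true  ∷ τ} d = Product.map suc (cong (true ∷_)) (hamming≡1⇒flip d)

hamming-flip-flip : (σ : Vec Bool m) {i j : Fin m} → i ≢ j → hamming σ (flip (flip σ i) j) ≡ 2
hamming-flip-flip (a ∷ σ) {zero}  {zero}  0≢0 = contradiction refl 0≢0
hamming-flip-flip (a ∷ σ) {zero}  {suc j} _   rewrite xor-not a = cong suc (hamming-flip σ j)
hamming-flip-flip (a ∷ σ) {suc i} {zero}  _   rewrite xor-not a = cong suc (hamming-flip σ i)
hamming-flip-flip (a ∷ σ) {suc i} {suc j} i≢j rewrite BoolP.xor-same a = hamming-flip-flip σ (i≢j ∘ cong suc)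

flip≢flip-flip : ∀ (σ : Vec Bool n) {k h h′} → h ≢ h′ → flip σ k ≢ flip (flip σ h) h′
flip≢flip-flip σ {k} h≢h′ eq =
  contradiction (trans (sym (hamming-flip σ k)) (trans (cong (hamming σ) eq) (hamming-flip-flip σ h≢h′))) λ ()

-- `dist` and `∂chain` are computed by helpers local to their `where` blocks, which cannot be named here.
-- Each helper is characterised by its defining clauses, which hold by `refl`, and is itself found by
-- unification; this needs an occurrence where it is applied to variables only, which the `with`s
-- below create (abstracting a chain before its tail, hence listing the chain last).

DistHelper : RealField → ℕ → Set
DistHelper F d = ∀ {n} → Arrangement F d n → Vec Bool n → Vec Bool n →
                 ∀ {m} → (Fin m → Bool) → (Fin m → Bool) → ℕ

dist-helper≡hamming : ∀ {F d} (go : DistHelper F d) →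
  (∀ {n} A σ τ f g → go {n} A σ τ {zero} f g ≡ 0) →
  (∀ {n} A σ τ {m} f g →
     go {n} A σ τ {suc m} f g ≡ (if f zero xor g zero then 1 else 0) ℕ.+ go A σ τ (f ∘ suc) (g ∘ suc)) →
  ∀ {n} A σ τ {m} f g → go {n} A σ τ {m} f g ≡ hamming (tabulate f) (tabulate g)
dist-helper≡hamming go go-zero go-suc A σ τ {zero}  f g = go-zero A σ τ f g
dist-helper≡hamming go go-zero go-suc A σ τ {suc m} f g =
  trans (go-suc A σ τ f g) (cong (_ ℕ.+_) (dist-helper≡hamming go go-zero go-suc A σ τ (f ∘ suc) (g ∘ suc)))

dist≡hamming : ∀ {F d n} (A : Arrangement F d n) (σ τ : Vec Bool n) → dist A σ τ ≡ hamming σ τ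
dist≡hamming {F} {d} with dist-helper≡hamming {F} {d} _ (λ _ _ _ _ _ → refl) (λ _ _ _ _ _ → refl)
... | helper≡hamming = go
  where
  go : ∀ {n} (A : Arrangement F d n) σ τ → dist A σ τ ≡ hamming σ τ
  go A [] [] = refl
  go {suc m} A (a ∷ σ) (b ∷ τ)
    with suc m | A | a ∷ σ | b ∷ τ | lookup σ | lookup τ | VecP.tabulate∘lookup σ | VecP.tabulate∘lookup τ
  ... | _ | A′ | σ′ | τ′ | f | g | f≡σ | g≡τ =
    cong (_ ℕ.+_) (trans (helper≡hamming A′ σ′ τ′ f g) (cong₂ hamming f≡σ g≡τ))

module _ {F : RealField} {d n : ℕ} (A : Arrangement F d n) where

  faces : ℤ → Chain A → FSum A
  faces s (a ∷ b ∷ c ∷ r) =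
    (if geodesic A a b c then (s , a ∷ c ∷ r) ∷ [] else []) ++ map (map₂ (a ∷_)) (faces (ℤ.- s) (b ∷ c ∷ r))
  faces s _ = []

BoundaryHelper : RealField → ℕ → Set
BoundaryHelper F d = ∀ {n} (A : Arrangement F d n) → Chain A → ℤ → Chain A → Chain A → FSum A

boundary-helper≡faces : ∀ {F d} (go : BoundaryHelper F d) →
  (∀ {n} A x s pre → go {n} A x s pre [] ≡ []) →
  (∀ {n} A x s pre a → go {n} A x s pre (a ∷ []) ≡ []) →
  (∀ {n} A x s pre a b → go {n} A x s pre (a ∷ b ∷ []) ≡ []) →
  (∀ {n} A x s pre a b c r → go {n} A x s pre (a ∷ b ∷ c ∷ r) ≡
     (if geodesic A a b c then (s , reverse pre ++ a ∷ c ∷ r) ∷ [] else []) ++ go A x (ℤ.- s) (a ∷ pre) (b ∷ c ∷ r)) →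
  ∀ {n} A x s pre y → go {n} A x s pre y ≡ map (map₂ (reverse pre ++_)) (faces A s y)
boundary-helper≡faces go go-0 go-1 go-2 go-3 = helper≡faces
  where
  helper≡faces : ∀ {n} A x s pre y → go {n} A x s pre y ≡ map (map₂ (reverse pre ++_)) (faces A s y)
  helper≡faces A x s pre []           = go-0 A x s pre
  helper≡faces A x s pre (a ∷ [])     = go-1 A x s pre a
  helper≡faces A x s pre (a ∷ b ∷ []) = go-2 A x s pre a b
  helper≡faces A x s pre (a ∷ b ∷ c ∷ r) = begin
    go A x s pre (a ∷ b ∷ c ∷ r)
      ≡⟨ go-3 A x s pre a b c r ⟩
    (if geodesic A a b c then prefixed (s , a ∷ c ∷ r) ∷ [] else []) ++ go A x (ℤ.- s) (a ∷ pre) (b ∷ c ∷ r)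
      ≡⟨ cong₂ _++_ (sym (BoolP.if-float (map prefixed) (geodesic A a b c)))
                    (helper≡faces A x (ℤ.- s) (a ∷ pre) (b ∷ c ∷ r)) ⟩
    map prefixed first ++ map (map₂ (reverse (a ∷ pre) ++_)) rest
      ≡⟨ cong (map prefixed first ++_) (trans (ListP.map-cong push-a rest) (ListP.map-∘ rest)) ⟩
    map prefixed first ++ map prefixed (map (map₂ (a ∷_)) rest)
      ≡⟨ ListP.map-++ prefixed first (map (map₂ (a ∷_)) rest) ⟨
    map prefixed (faces A s (a ∷ b ∷ c ∷ r)) ∎
    where
    open ≡-Reasoning
    prefixed = map₂ (reverse pre ++_)
    first = if geodesic A a b c then (s , a ∷ c ∷ r) ∷ [] else []
    rest = faces A (ℤ.- s) (b ∷ c ∷ r)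
    push-a : ∀ p → map₂ (reverse (a ∷ pre) ++_) p ≡ prefixed (map₂ (a ∷_) p)
    push-a (k , z) =
      cong (k ,_) (trans (cong (_++ z) (ListP.unfold-reverse a pre)) (ListP.++-assoc (reverse pre) (a ∷ []) z))

∂chain≡faces : ∀ {F d n} (A : Arrangement F d n) x → ∂chain A x ≡ faces A (+ 1) x
∂chain≡faces {F} {d}
  with boundary-helper≡faces {F} {d} _ (λ _ _ _ _ → refl) (λ _ _ _ _ _ → refl) (λ _ _ _ _ _ _ → refl)
                                       (λ _ _ _ _ _ _ _ _ → refl)
... | helper≡faces = go
  where
  go : ∀ {n} (A : Arrangement F d n) x → ∂chain A x ≡ faces A (+ 1) x
  go A []           = refl
  go A (a ∷ [])     = refl
  go A (a ∷ b ∷ []) = refl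
  go A (a ∷ b ∷ c ∷ r)
    with (Chain A ∋ b ∷ c ∷ r) | -[1+ 0 ] | (Chain A ∋ a ∷ []) in pre≡ | (Chain A ∋ a ∷ b ∷ c ∷ r)
  ... | y | s | pre | x = cong (_ ++_) (trans (helper≡faces A x s pre y) (ListP.map-cong drop-pre (faces A s y)))
    where
    drop-pre : ∀ p → map₂ (reverse pre ++_) p ≡ map₂ (a ∷_) p
    drop-pre (k , z) = cong (λ p → k , reverse p ++ z) (sym pre≡)

-- Coefficients of formal sums

module _ {F : RealField} {d n : ℕ} (A : Arrangement F d n) where
  open import Data.Integer using (_+_; _*_)

  δ : Chain A → Chain A → ℤ
  δ x y = if does (_≟C_ A x y) then + 1 else + 0

  δ-refl : ∀ x → δ x x ≡ + 1
  δ-refl x with _≟C_ A x x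
  ... | yes _  = refl
  ... | no x≢x = contradiction refl x≢x

  δ-≢ : ∀ {x y} → x ≢ y → δ x y ≡ + 0
  δ-≢ {x} {y} x≢y with _≟C_ A x y
  ... | yes x≡y = contradiction x≡y x≢y
  ... | no _    = refl

  δ-cong : ∀ {x y x′ y′} → (x ≡ y → x′ ≡ y′) → (x′ ≡ y′ → x ≡ y) → δ x y ≡ δ x′ y′
  δ-cong {x} {y} {x′} {y′} to from with _≟C_ A x y
  ... | yes x≡y = sym (trans (cong (δ x′) (sym (to x≡y))) (δ-refl x′))
  ... | no x≢y  = sym (δ-≢ (x≢y ∘ from))

  δ-∷ : ∀ a x y → δ (a ∷ x) (a ∷ y) ≡ δ x y
  δ-∷ a x y = δ-cong {a ∷ x} {a ∷ y} ListP.∷-injectiveʳ (cong (a ∷_))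

  δ-⊎ : ∀ {x y x′ y₁ y₂} → (x ≡ y → x′ ≡ y₁ ⊎ x′ ≡ y₂) → (x′ ≡ y₁ ⊎ x′ ≡ y₂ → x ≡ y) → y₁ ≢ y₂ →
        δ x y ≡ δ x′ y₁ + δ x′ y₂
  δ-⊎ {x} {y} {x′} {y₁} {y₂} to from y₁≢y₂ with _≟C_ A x′ y₁ | _≟C_ A x′ y₂
  ... | yes x′≡y₁ | yes x′≡y₂ = contradiction (trans (sym x′≡y₁) x′≡y₂) y₁≢y₂
  ... | yes x′≡y₁ | no _      = trans (cong (δ x) (sym (from (inj₁ x′≡y₁)))) (δ-refl x)
  ... | no _      | yes x′≡y₂ = trans (cong (δ x) (sym (from (inj₂ x′≡y₂)))) (δ-refl x)
  ... | no x′≢y₁  | no x′≢y₂  = δ-≢ ([ x′≢y₁ , x′≢y₂ ] ∘ to)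

  δ+δ-≢ : ∀ ε x y₁ y₂ → x ≢ y₁ → x ≢ y₂ → ε * (δ x y₁ + δ x y₂) ≡ + 0
  δ+δ-≢ ε x y₁ y₂ x≢y₁ x≢y₂ = trans (cong (ε *_) (cong₂ _+_ (δ-≢ x≢y₁) (δ-≢ x≢y₂))) (ℤP.*-zeroʳ ε)

  coeff-∷ : ∀ k x c y → coeff A ((k , x) ∷ c) y ≡ k * δ x y + coeff A c y
  coeff-∷ k x c y with _≟C_ A x y
  ... | yes _ = cong (_+ coeff A c y) (sym (ℤP.*-identityʳ k))
  ... | no _  = sym (trans (cong (_+ coeff A c y) (ℤP.*-zeroʳ k)) (ℤP.+-identityˡ _))

  coeff-++ : ∀ c c′ y → coeff A (c ++ c′) y ≡ coeff A c y + coeff A c′ y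
  coeff-++ [] c′ y = sym (ℤP.+-identityˡ _)
  coeff-++ ((k , x) ∷ c) c′ y = begin
    coeff A ((k , x) ∷ c ++ c′) y            ≡⟨ coeff-∷ k x (c ++ c′) y ⟩
    k * δ x y + coeff A (c ++ c′) y          ≡⟨ cong (λ r → k * δ x y + r) (coeff-++ c c′ y) ⟩
    k * δ x y + (coeff A c y + coeff A c′ y) ≡⟨ ℤP.+-assoc (k * δ x y) _ _ ⟨
    k * δ x y + coeff A c y + coeff A c′ y   ≡⟨ cong (_+ coeff A c′ y) (coeff-∷ k x c y) ⟨
    coeff A ((k , x) ∷ c) y + coeff A c′ y   ∎
    where open ≡-Reasoning

  coeff-∉ : ∀ {y} c → All (λ p → proj₂ p ≢ y) c → coeff A c y ≡ + 0
  coeff-∉ [] [] = refl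
  coeff-∉ {y} ((k , x) ∷ c) (x≢y ∷ y∉c) =
    trans (coeff-∷ k x c y) (trans (cong₂ (λ e r → k * e + r) (δ-≢ x≢y) (coeff-∉ c y∉c)) (cong (_+ + 0) (ℤP.*-zeroʳ k)))

  coeff≢0⇒∈ : ∀ c y → coeff A c y ≢ + 0 → Any ((y ≡_) ∘ proj₂) c
  coeff≢0⇒∈ [] y c≢0 = contradiction refl c≢0
  coeff≢0⇒∈ ((k , x) ∷ c) y c≢0 with _≟C_ A x y
  ... | yes x≡y = here (sym x≡y)
  ... | no _    = there (coeff≢0⇒∈ c y c≢0)

  coeff-map-injective : ∀ {f : Chain A → Chain A} → (∀ {x y} → f x ≡ f y → x ≡ y) →
                        ∀ c y → coeff A (map (map₂ f) c) (f y) ≡ coeff A c y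
  coeff-map-injective f-inj [] y = refl
  coeff-map-injective {f} f-inj ((k , x) ∷ c) y = begin
    coeff A ((k , f x) ∷ map (map₂ f) c) (f y)         ≡⟨ coeff-∷ k (f x) _ (f y) ⟩
    k * δ (f x) (f y) + coeff A (map (map₂ f) c) (f y) ≡⟨ cong₂ (λ e r → k * e + r) (δ-cong f-inj (cong f))
                                                                                     (coeff-map-injective f-inj c y) ⟩
    k * δ x y + coeff A c y                            ≡⟨ coeff-∷ k x c y ⟨
    coeff A ((k , x) ∷ c) y                            ∎
    where open ≡-Reasoning

  coeff-map-∉ : ∀ {f : Chain A → Chain A} {z} → (∀ x → f x ≢ z) → ∀ c → coeff A (map (map₂ f) c) z ≡ + 0
  coeff-map-∉ z∉f c = coeff-∉ (map (map₂ _) c) (AllP.map⁺ (All.universal (λ p → z∉f (proj₂ p)) c))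

  coeff-∂ : ∀ {P : Chain A → Set} (ε : ℤ) {z y y′} →
            (∀ {x} → P x → coeff A (∂chain A x) z ≡ ε * (δ x y + δ x y′)) →
            ∀ c → All (P ∘ proj₂) c → coeff A (∂ A c) z ≡ ε * (coeff A c y + coeff A c y′)
  coeff-∂ ε hyp [] [] = sym (ℤP.*-zeroʳ ε)
  coeff-∂ ε {z} {y} {y′} hyp ((k , x) ∷ c) (px ∷ pc) = begin
    coeff A (scaled k (∂chain A x) ++ ∂ A c) z
      ≡⟨ coeff-++ (scaled k (∂chain A x)) (∂ A c) z ⟩
    coeff A (scaled k (∂chain A x)) z + coeff A (∂ A c) z
      ≡⟨ cong₂ _+_ (trans (coeff-scaled k (∂chain A x)) (cong (k *_) (hyp px))) (coeff-∂ ε hyp c pc) ⟩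
    k * (ε * (δ x y + δ x y′)) + ε * (coeff A c y + coeff A c y′)
      ≡⟨ rearrange k ε (δ x y) (δ x y′) (coeff A c y) (coeff A c y′) ⟩
    ε * ((k * δ x y + coeff A c y) + (k * δ x y′ + coeff A c y′))
      ≡⟨ cong (ε *_) (cong₂ _+_ (coeff-∷ k x c y) (coeff-∷ k x c y′)) ⟨
    ε * (coeff A ((k , x) ∷ c) y + coeff A ((k , x) ∷ c) y′) ∎
    where
    open ≡-Reasoning
    rearrange : ∀ k ε a b p q → k * (ε * (a + b)) + ε * (p + q) ≡ ε * ((k * a + p) + (k * b + q))
    rearrange = solve-∀
    scaled : ℤ → FSum A → FSum A
    scaled k = map (λ q → (k * proj₁ q , proj₂ q))
    coeff-scaled : ∀ k l → coeff A (scaled k l) z ≡ k * coeff A l z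
    coeff-scaled k [] = sym (ℤP.*-zeroʳ k)
    coeff-scaled k ((j , w) ∷ l) = begin
      coeff A ((k * j , w) ∷ scaled k l) z    ≡⟨ coeff-∷ (k * j) w _ z ⟩
      k * j * δ w z + coeff A (scaled k l) z  ≡⟨ cong₂ _+_ (ℤP.*-assoc k j (δ w z)) (coeff-scaled k l) ⟩
      k * (j * δ w z) + k * coeff A l z       ≡⟨ ℤP.*-distribˡ-+ k _ _ ⟨
      k * (j * δ w z + coeff A l z)           ≡⟨ cong (k *_) (coeff-∷ j w l z) ⟨
      k * coeff A ((j , w) ∷ l) z             ∎

-- Galleries and their faces

gallery galleryTail : Vec Bool n → List (Fin n) → List (Vec Bool n)
gallery σ w = σ ∷ galleryTail σ w
galleryTail σ []      = []
galleryTail σ (i ∷ w) = gallery (flip σ i) w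

-- `gallery σ (u ++ h ∷ h′ ∷ w)` with the vertex between the crossings of `h` and `h′` removed
shortcut shortcutTail : Vec Bool n → List (Fin n) → Fin n → Fin n → List (Fin n) → List (Vec Bool n)
shortcut σ u h h′ w = σ ∷ shortcutTail σ u h h′ w
shortcutTail σ []      h h′ w = gallery (flip (flip σ h) h′) w
shortcutTail σ (g ∷ u) h h′ w = shortcut (flip σ g) u h h′ w

galleryFaces : ℤ → Vec Bool n → List (Fin n) → List (ℤ × List (Vec Bool n))
galleryFaces s σ (g ∷ g′ ∷ w) =
  (if does (g FinP.≟ g′) then [] else (s , shortcut σ [] g g′ w) ∷ [])
  ++ map (map₂ (σ ∷_)) (galleryFaces (ℤ.- s) (flip σ g) (g′ ∷ w))
galleryFaces s σ _ = []

alternate : ℤ → List (Fin n) → ℤ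
alternate s []      = s
alternate s (_ ∷ u) = alternate (ℤ.- s) u

∣alternate∣ : ∀ s (u : List (Fin n)) → ℤ.∣ alternate s u ∣ ≡ ℤ.∣ s ∣
∣alternate∣ s []      = refl
∣alternate∣ s (_ ∷ u) = trans (∣alternate∣ (ℤ.- s) u) (ℤP.∣-i∣≡∣i∣ s)

endpoint : Vec Bool n → List (Fin n) → Vec Bool n
endpoint = foldl flip

endpoint-∈ : ∀ (σ : Vec Bool n) u w → endpoint σ u ∈ gallery σ (u ++ w)
endpoint-∈ σ []      w = here refl
endpoint-∈ σ (g ∷ u) w = there (endpoint-∈ (flip σ g) u w)

gallery-injective : ∀ {σ τ : Vec Bool n} {w v} → gallery σ w ≡ gallery τ v → σ ≡ τ × w ≡ v
gallery-injective {w = []}    {[]}    refl = refl , refl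
gallery-injective {σ = σ} {w = i ∷ w} {j ∷ v} eq with ListP.∷-injectiveˡ eq
... | refl with gallery-injective (ListP.∷-injectiveʳ eq)
...   | flipσi≡flipσj , w≡v = refl , cong₂ _∷_ (flip-injective σ flipσi≡flipσj) w≡v

gallery-≢ : ∀ (σ : Vec Bool n) w τ v → w ≢ v → gallery σ w ≢ gallery τ v
gallery-≢ σ w τ v w≢v = w≢v ∘ proj₂ ∘ gallery-injective

short≢long : ∀ {w′} (u : List (Fin n)) {h h′ w} → length w′ ℕ.< 2 → w′ ≢ u ++ h ∷ h′ ∷ w
short≢long {w′} u {h} {h′} {w} short eq =
  ℕP.<⇒≱ short (subst (λ v → 2 ℕ.≤ length v) (sym eq)
                      (ℕP.≤-trans (ℕ.s≤s (ℕ.s≤s ℕ.z≤n)) (ListP.length-++-≤ʳ (h ∷ h′ ∷ w) {u})))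

gallery≢shortcut : ∀ {h h′} → h ≢ h′ → ∀ (σ τ : Vec Bool n) u v w → gallery τ v ≢ shortcut σ u h h′ w
gallery≢shortcut h≢h′ σ τ []      (k ∷ v) w eq with ListP.∷-injectiveˡ eq
... | refl = flip≢flip-flip σ h≢h′ (ListP.∷-injectiveˡ (ListP.∷-injectiveʳ eq))
gallery≢shortcut h≢h′ σ τ (g ∷ u) (k ∷ v) w eq =
  gallery≢shortcut h≢h′ (flip σ g) (flip τ k) u v w (ListP.∷-injectiveʳ eq)

ShortcutOf : Vec Bool n → List (Vec Bool n) → Set
ShortcutOf σ x = ∃ λ u → ∃₂ λ h h′ → ∃ λ w → h ≢ h′ × x ≡ shortcut σ u h h′ w

galleryFaces-shortcuts : ∀ s (σ : Vec Bool n) w → All (ShortcutOf σ ∘ proj₂) (galleryFaces s σ w)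
galleryFaces-shortcuts s σ []           = []
galleryFaces-shortcuts s σ (g ∷ [])     = []
galleryFaces-shortcuts s σ (g ∷ g′ ∷ w) =
  AllP.++⁺ first (AllP.map⁺ (All.map extend (galleryFaces-shortcuts (ℤ.- s) (flip σ g) (g′ ∷ w))))
  where
  first : All (ShortcutOf σ ∘ proj₂) (if does (g FinP.≟ g′) then [] else (s , shortcut σ [] g g′ w) ∷ [])
  first with g FinP.≟ g′
  ... | yes _   = []
  ... | no g≢g′ = ([] , g , g′ , w , g≢g′ , refl) ∷ []
  extend : ∀ {x} → ShortcutOf (flip σ g) x → ShortcutOf σ (σ ∷ x)
  extend (u , h , h′ , v , h≢h′ , refl) = g ∷ u , h , h′ , v , h≢h′ , refl

module _ {F : RealField} {d n : ℕ} (A : Arrangement F d n) where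
  open import Data.Integer using (_+_; _*_)

  geodesic-gallery : ∀ σ g g′ → geodesic A σ (flip σ g) (flip (flip σ g) g′) ≡ not (does (g FinP.≟ g′))
  geodesic-gallery σ g g′ =
    trans (cong₂ _≡ᵇ_ (dist≡hamming A σ υ)
                      (cong₂ ℕ._+_ (trans (dist≡hamming A σ τ) (hamming-flip σ g))
                                   (trans (dist≡hamming A τ υ) (hamming-flip τ g′))))
          (two-steps (g FinP.≟ g′))
    where
    τ = flip σ g
    υ = flip τ g′
    two-steps : (g≟g′ : Dec (g ≡ g′)) → (hamming σ υ ≡ᵇ 2) ≡ not (does g≟g′)
    two-steps (yes refl) = cong (_≡ᵇ 2) (trans (cong (hamming σ) (flip-involutive σ g)) (hamming-refl σ))
    two-steps (no g≢g′)  = cong (_≡ᵇ 2) (hamming-flip-flip σ g≢g′)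

  faces-gallery : ∀ s σ w → faces A s (gallery σ w) ≡ galleryFaces s σ w
  faces-gallery s σ []           = refl
  faces-gallery s σ (g ∷ [])     = refl
  faces-gallery s σ (g ∷ g′ ∷ w) =
    cong₂ _++_ (trans (cong (λ b → if b then (s , shortcut σ [] g g′ w) ∷ [] else []) (geodesic-gallery σ g g′))
                      (BoolP.if-not (does (g FinP.≟ g′))))
               (cong (map (map₂ (σ ∷_))) (faces-gallery (ℤ.- s) (flip σ g) (g′ ∷ w)))

  galleryFaces-∌-gallery : ∀ s σ w τ v → coeff A (galleryFaces s σ w) (gallery τ v) ≡ + 0
  galleryFaces-∌-gallery s σ w τ v = coeff-∉ A (galleryFaces s σ w) (All.map not-gallery (galleryFaces-shortcuts s σ w))
    where
    not-gallery : ∀ {x} → ShortcutOf σ x → x ≢ gallery τ v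
    not-gallery (u , h , h′ , w′ , h≢h′ , refl) eq = gallery≢shortcut h≢h′ σ τ u v w′ (sym eq)

  δ-pair : Chain A → Vec Bool n → List (Fin n) → Fin n → Fin n → List (Fin n) → ℤ
  δ-pair x b u h h′ w = δ A x (gallery b (u ++ h ∷ h′ ∷ w)) + δ A x (gallery b (u ++ h′ ∷ h ∷ w))

  faces-at-first-shortcut : ∀ {h h′} → h ≢ h′ → ∀ b w s a g g′ w″ →
    coeff A (galleryFaces s a (g ∷ g′ ∷ w″)) (shortcut b [] h h′ w) ≡ s * δ-pair (gallery a (g ∷ g′ ∷ w″)) b [] h h′ w
  faces-at-first-shortcut {h} {h′} h≢h′ b w s a g g′ w″ =
    trans (coeff-++ A first (map (map₂ (a ∷_)) rest) Z)
          (trans (cong₂ _+_ first-coeff rest-coeff) (ℤP.+-identityʳ _))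
    where
    Z = shortcut b [] h h′ w
    first = if does (g FinP.≟ g′) then [] else (s , shortcut a [] g g′ w″) ∷ []
    rest = galleryFaces (ℤ.- s) (flip a g) (g′ ∷ w″)
    x = gallery a (g ∷ g′ ∷ w″)
    X₁ = gallery b (h ∷ h′ ∷ w)
    X₂ = gallery b (h′ ∷ h ∷ w)
    first-coeff : coeff A first Z ≡ s * (δ A x X₁ + δ A x X₂)
    first-coeff with g FinP.≟ g′
    ... | yes refl = sym (δ+δ-≢ A s x X₁ X₂ (gallery-≢ a (g ∷ g ∷ w″) b (h ∷ h′ ∷ w) λ { refl → h≢h′ refl })
                                            (gallery-≢ a (g ∷ g ∷ w″) b (h′ ∷ h ∷ w) λ { refl → h≢h′ refl }))
    ... | no g≢g′  =
      trans (coeff-∷ A s (shortcut a [] g g′ w″) [] Z)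
            (trans (ℤP.+-identityʳ _) (cong (s *_) (δ-⊎ A {shortcut a [] g g′ w″} {Z} {x} {X₁} {X₂} to from X₁≢X₂)))
      where
      to : shortcut a [] g g′ w″ ≡ Z → x ≡ X₁ ⊎ x ≡ X₂
      to eq with ListP.∷-injectiveˡ eq | gallery-injective (ListP.∷-injectiveʳ eq)
      ... | refl | flips≡ , refl with flip-flip-injective a g≢g′ flips≡
      ...   | inj₁ (refl , refl) = inj₁ refl
      ...   | inj₂ (refl , refl) = inj₂ refl
      from : x ≡ X₁ ⊎ x ≡ X₂ → shortcut a [] g g′ w″ ≡ Z
      from (inj₁ eq) with gallery-injective eq
      ... | refl , refl = refl
      from (inj₂ eq) with gallery-injective eq
      ... | refl , refl = cong (λ τ → b ∷ gallery τ w) (flip-comm b h′ h)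
      X₁≢X₂ : X₁ ≢ X₂
      X₁≢X₂ = gallery-≢ b (h ∷ h′ ∷ w) b (h′ ∷ h ∷ w) (h≢h′ ∘ ListP.∷-injectiveˡ)
    rest-coeff : coeff A (map (map₂ (a ∷_)) rest) Z ≡ + 0
    rest-coeff with VecP.≡-dec BoolP._≟_ a b
    ... | yes refl = trans (coeff-map-injective A ListP.∷-injectiveʳ rest (gallery (flip (flip b h) h′) w))
                           (galleryFaces-∌-gallery (ℤ.- s) (flip a g) (g′ ∷ w″) (flip (flip b h) h′) w)
    ... | no a≢b   = coeff-map-∉ A (λ _ → a≢b ∘ ListP.∷-injectiveˡ) rest

  faces-at-later-shortcut : ∀ {h h′} → h ≢ h′ → ∀ k u b w s a g g′ w″ →
    (a ≡ b → coeff A (galleryFaces (ℤ.- s) (flip a g) (g′ ∷ w″)) (shortcut (flip b k) u h h′ w)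
               ≡ alternate (ℤ.- s) u * δ-pair (gallery (flip a g) (g′ ∷ w″)) (flip b k) u h h′ w) →
    coeff A (galleryFaces s a (g ∷ g′ ∷ w″)) (shortcut b (k ∷ u) h h′ w)
      ≡ alternate (ℤ.- s) u * δ-pair (gallery a (g ∷ g′ ∷ w″)) b (k ∷ u) h h′ w
  faces-at-later-shortcut {h} {h′} h≢h′ k u b w s a g g′ w″ later =
    trans (coeff-++ A first (map (map₂ (a ∷_)) rest) Z)
          (trans (cong₂ _+_ first-coeff (rest-coeff (VecP.≡-dec BoolP._≟_ a b))) (ℤP.+-identityˡ _))
    where
    Z = shortcut b (k ∷ u) h h′ w
    first = if does (g FinP.≟ g′) then [] else (s , shortcut a [] g g′ w″) ∷ []
    rest = galleryFaces (ℤ.- s) (flip a g) (g′ ∷ w″)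
    x′ = gallery (flip a g) (g′ ∷ w″)
    X₁′ = gallery (flip b k) (u ++ h ∷ h′ ∷ w)
    X₂′ = gallery (flip b k) (u ++ h′ ∷ h ∷ w)
    first-coeff : coeff A first Z ≡ + 0
    first-coeff with g FinP.≟ g′
    ... | yes _   = refl
    ... | no g≢g′ = coeff-∉ A ((s , shortcut a [] g g′ w″) ∷ []) (skips-elsewhere ∷ [])
      where
      skips-elsewhere : shortcut a [] g g′ w″ ≢ Z
      skips-elsewhere eq with ListP.∷-injectiveˡ eq
      ... | refl = flip≢flip-flip a g≢g′ (sym (ListP.∷-injectiveˡ (ListP.∷-injectiveʳ eq)))
    rest-coeff : Dec (a ≡ b) →
                 coeff A (map (map₂ (a ∷_)) rest) Z
                   ≡ alternate (ℤ.- s) u * (δ A (a ∷ x′) (b ∷ X₁′) + δ A (a ∷ x′) (b ∷ X₂′))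
    rest-coeff (yes refl) = begin
      coeff A (map (map₂ (a ∷_)) rest) (a ∷ shortcut (flip a k) u h h′ w)
        ≡⟨ coeff-map-injective A ListP.∷-injectiveʳ rest (shortcut (flip a k) u h h′ w) ⟩
      coeff A rest (shortcut (flip a k) u h h′ w)
        ≡⟨ later refl ⟩
      alternate (ℤ.- s) u * (δ A x′ X₁′ + δ A x′ X₂′)
        ≡⟨ cong (alternate (ℤ.- s) u *_) (cong₂ _+_ (δ-∷ A a x′ X₁′) (δ-∷ A a x′ X₂′)) ⟨
      alternate (ℤ.- s) u * (δ A (a ∷ x′) (a ∷ X₁′) + δ A (a ∷ x′) (a ∷ X₂′)) ∎
      where open ≡-Reasoning
    rest-coeff (no a≢b) =
      trans (coeff-map-∉ A (λ _ → a≢b ∘ ListP.∷-injectiveˡ) rest)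
            (sym (δ+δ-≢ A (alternate (ℤ.- s) u) (a ∷ x′) (b ∷ X₁′) (b ∷ X₂′) (a≢b ∘ ListP.∷-injectiveˡ)
                                                                              (a≢b ∘ ListP.∷-injectiveˡ)))

  short-gallery-misses : ∀ ε a w′ b u h h′ w → length w′ ℕ.< 2 → ε * δ-pair (gallery a w′) b u h h′ w ≡ + 0
  short-gallery-misses ε a w′ b u h h′ w short =
    δ+δ-≢ A ε (gallery a w′) (gallery b (u ++ h ∷ h′ ∷ w)) (gallery b (u ++ h′ ∷ h ∷ w))
          (gallery-≢ a w′ b (u ++ h ∷ h′ ∷ w) (short≢long u short))
          (gallery-≢ a w′ b (u ++ h′ ∷ h ∷ w) (short≢long u short))

  -- A face of a gallery has a single step crossing two hyperplanes; it locates the removed vertex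
  -- and determines the two crossings up to order.
  coeff-galleryFaces-shortcut : ∀ {h h′} → h ≢ h′ → ∀ u b w s a w′ →
    coeff A (galleryFaces s a w′) (shortcut b u h h′ w) ≡ alternate s u * δ-pair (gallery a w′) b u h h′ w
  coeff-galleryFaces-shortcut h≢h′ []      b w s a (g ∷ g′ ∷ w″) =
    faces-at-first-shortcut h≢h′ b w s a g g′ w″
  coeff-galleryFaces-shortcut h≢h′ (k ∷ u) b w s a (g ∷ g′ ∷ w″) =
    faces-at-later-shortcut h≢h′ k u b w s a g g′ w″
      λ { refl → coeff-galleryFaces-shortcut h≢h′ u (flip a k) w (ℤ.- s) (flip a g) (g′ ∷ w″) }
  coeff-galleryFaces-shortcut {h} {h′} _ u b w s a [] =
    sym (short-gallery-misses (alternate s u) a [] b u h h′ w (ℕ.s≤s ℕ.z≤n))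
  coeff-galleryFaces-shortcut {h} {h′} _ u b w s a (g ∷ []) =
    sym (short-gallery-misses (alternate s u) a (g ∷ []) b u h h′ w (ℕ.s≤s (ℕ.s≤s ℕ.z≤n)))

-- Cells of an arrangement

module OrderedField (F : RealField) where
  open RealField F public

  commutativeRing : CommutativeRing _ _
  commutativeRing = record { isCommutativeRing = isCommutativeRing }

  open IsCommutativeRing isCommutativeRing public
    using (+-comm; +-identityˡ; +-identityʳ; -‿inverseˡ; -‿inverseʳ; *-comm; *-assoc; distribˡ; zeroˡ; zeroʳ)
  open IsStrictTotalOrder <-isStrictTotalOrder public using (irrefl; compare; _<?_; _≟_) renaming (trans to <-trans)
  open import Algebra.Properties.Ring (CommutativeRing.ring commutativeRing) public
    using (-‿distribˡ-*; -‿distribʳ-*; -‿involutive)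
  open import Algebra.Properties.CommutativeSemigroup (CommutativeRing.*-commutativeSemigroup commutativeRing) public
    using (x∙yz≈y∙xz)
  open import Algebra.Properties.Semiring.Sum (CommutativeRing.semiring commutativeRing) public
    using (sum; sum-cong-≗; ∑-distrib-+; ∑-comm; *-distribˡ-sum; *-distribʳ-sum; sum-replicate-zero)

  Sign : Bool → Carrier → Set
  Sign b x = if b then 0# < x else x < 0#

  positive? : Carrier → Bool
  positive? x = does (0# <? x)

  <-irrefl : ∀ {x} → ¬ x < x
  <-irrefl = irrefl refl

  ¬Sign-0 : ∀ b → ¬ Sign b 0#
  ¬Sign-0 true  = <-irrefl
  ¬Sign-0 false = <-irrefl

  neg⇒-pos : ∀ {x} → x < 0# → 0# < - x
  neg⇒-pos {x} x<0 = subst₂ _<_ (-‿inverseʳ x) (+-identityˡ (- x)) (+-mono-< (- x) x<0)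

  pos⇒-neg : ∀ {x} → 0# < x → - x < 0#
  pos⇒-neg {x} 0<x = subst₂ _<_ (+-identityˡ (- x)) (-‿inverseʳ x) (+-mono-< (- x) 0<x)

  ¬pos-≢0⇒neg : ∀ {x} → ¬ 0# < x → x ≢ 0# → x < 0#
  ¬pos-≢0⇒neg {x} 0≮x x≢0 with compare x 0#
  ... | tri< x<0 _ _ = x<0
  ... | tri≈ _ x≡0 _ = contradiction x≡0 x≢0
  ... | tri> _ _ 0<x = contradiction 0<x 0≮x

  pos+pos : ∀ {x y} → 0# < x → 0# < y → 0# < x + y
  pos+pos {x} {y} 0<x 0<y = <-trans 0<y (subst (_< x + y) (+-identityˡ y) (+-mono-< y 0<x))

  neg+neg : ∀ {x y} → x < 0# → y < 0# → x + y < 0#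
  neg+neg {x} {y} x<0 y<0 = <-trans (subst (x + y <_) (+-identityˡ y) (+-mono-< y x<0)) y<0

  nonneg+pos : ∀ {x y} → 0# ≤ x → 0# < y → 0# < x + y
  nonneg+pos (inj₁ 0<x)           0<y = pos+pos 0<x 0<y
  nonneg+pos {y = y} (inj₂ refl) 0<y = subst (0# <_) (sym (+-identityˡ y)) 0<y

  nonneg+nonneg : ∀ {x y} → 0# ≤ x → 0# ≤ y → 0# ≤ x + y
  nonneg+nonneg 0≤x (inj₁ 0<y)      = inj₁ (nonneg+pos 0≤x 0<y)
  nonneg+nonneg {x} 0≤x (inj₂ refl) = subst (0# ≤_) (sym (+-identityʳ x)) 0≤x

  pos*neg : ∀ {x y} → 0# < x → y < 0# → x * y < 0#
  pos*neg {x} {y} 0<x y<0 =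
    subst (_< 0#) (trans (-‿distribʳ-* x (- y)) (cong (x *_) (-‿involutive y))) (pos⇒-neg (*-pos 0<x (neg⇒-pos y<0)))

  neg*neg : ∀ {x y} → x < 0# → y < 0# → 0# < x * y
  neg*neg {x} {y} x<0 y<0 =
    subst (0# <_) (trans (sym (-‿distribˡ-* x (- y))) (trans (cong -_ (sym (-‿distribʳ-* x y))) (-‿involutive (x * y))))
          (*-pos (neg⇒-pos x<0) (neg⇒-pos y<0))

  same-sign⇒*-pos : ∀ {x y} → Sign (positive? x) y → x ≢ 0# → 0# < x * y
  same-sign⇒*-pos {x} y∼x x≢0 with 0# <? x
  ... | yes 0<x = *-pos 0<x y∼x
  ... | no 0≮x  = neg*neg (¬pos-≢0⇒neg 0≮x x≢0) y∼x

  same-sign⇒*-nonneg : ∀ {x y} → Sign (positive? x) y → 0# ≤ x * y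
  same-sign⇒*-nonneg {x} {y} y∼x with x ≟ 0#
  ... | yes refl = inj₂ (sym (zeroˡ y))
  ... | no x≢0   = inj₁ (same-sign⇒*-pos y∼x x≢0)

  positive-combination : ∀ b {α β x y} → 0# < α → 0# < β → Sign b x → Sign b y → Sign b (α * x + β * y)
  positive-combination true  0<α 0<β 0<x 0<y = pos+pos (*-pos 0<α 0<x) (*-pos 0<β 0<y)
  positive-combination false 0<α 0<β x<0 y<0 = neg+neg (pos*neg 0<α x<0) (pos*neg 0<β y<0)

  opposite-signs-cancel : ∀ b {p q} → Sign b p → Sign (not b) q →
                          ∃₂ λ α β → 0# < α × 0# < β × α * p + β * q ≡ 0#
  opposite-signs-cancel true {p} {q} 0<p q<0 =
    - q , p , neg⇒-pos q<0 , 0<p ,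
    trans (cong (_+ p * q) (trans (sym (-‿distribˡ-* q p)) (cong -_ (*-comm q p)))) (-‿inverseˡ (p * q))
  opposite-signs-cancel false {p} {q} p<0 0<q =
    q , - p , 0<q , neg⇒-pos p<0 ,
    trans (cong (λ t → q * p + t) (trans (sym (-‿distribˡ-* p q)) (cong -_ (*-comm p q)))) (-‿inverseʳ (q * p))

  sumF≡sum : ∀ {m} (f : Fin m → Carrier) → sumF F f ≡ sum f
  sumF≡sum {zero}  f = refl
  sumF≡sum {suc m} f = cong (λ t → f zero + t) (sumF≡sum (f ∘ suc))

  sumF-nonneg : ∀ {m} (t : Fin m → Carrier) → (∀ j → 0# ≤ t j) → 0# ≤ sumF F t
  sumF-nonneg {zero}  t t≥0 = inj₂ refl
  sumF-nonneg {suc m} t t≥0 = nonneg+nonneg (t≥0 zero) (sumF-nonneg (t ∘ suc) (t≥0 ∘ suc))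

  sumF-pos : ∀ {m} (t : Fin m → Carrier) → (∀ j → 0# ≤ t j) → ∀ i → 0# < t i → 0# < sumF F t
  sumF-pos t t≥0 zero    0<t₀ = subst (0# <_) (+-comm _ (t zero)) (nonneg+pos (sumF-nonneg (t ∘ suc) (t≥0 ∘ suc)) 0<t₀)
  sumF-pos t t≥0 (suc i) 0<tᵢ = nonneg+pos (t≥0 zero) (sumF-pos (t ∘ suc) (t≥0 ∘ suc) i 0<tᵢ)

Cube : (Vec Bool n → Set) → Vec Bool n → List (Fin n) → Set
Cube P σ []      = P σ
Cube P σ (h ∷ L) = Cube P σ L × Cube P (flip σ h) L

cube-map : ∀ {P Q : Vec Bool n → Set} → (∀ {σ} → P σ → Q σ) → ∀ L σ → Cube P σ L → Cube Q σ L
cube-map f []      σ p         = f p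
cube-map f (h ∷ L) σ (C₀ , C₁) = cube-map f L σ C₀ , cube-map f L (flip σ h) C₁

cube-corner : ∀ {P : Vec Bool n → Set} L σ τ → Cube P σ L → (∀ j → j ∉ L → lookup τ j ≡ lookup σ j) → P τ
cube-corner {P = P} [] σ τ p agree =
  subst P (trans (sym (VecP.tabulate∘lookup σ))
                 (trans (VecP.tabulate-cong (λ j → sym (agree j λ ()))) (VecP.tabulate∘lookup τ))) p
cube-corner (h ∷ L) σ τ (C₀ , C₁) agree with lookup τ h BoolP.≟ lookup σ h
... | yes τₕ≡σₕ = cube-corner L σ τ C₀ agree′
  where
  agree′ : ∀ j → j ∉ L → lookup τ j ≡ lookup σ j
  agree′ j j∉L with j FinP.≟ h
  ... | yes refl = τₕ≡σₕ
  ... | no j≢h   = agree j λ { (here j≡h) → j≢h j≡h ; (there j∈L) → j∉L j∈L }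
... | no τₕ≢σₕ = cube-corner L (flip σ h) τ C₁ agree′
  where
  agree′ : ∀ j → j ∉ L → lookup τ j ≡ lookup (flip σ h) j
  agree′ j j∉L with j FinP.≟ h
  ... | yes refl = trans (BoolP.¬-not τₕ≢σₕ) (sym (lookup-flip σ h))
  ... | no j≢h   = trans (agree j λ { (here j≡h) → j≢h j≡h ; (there j∈L) → j∉L j∈L }) (sym (lookup-flip-≢ σ j≢h))

module _ {F : RealField} {d n : ℕ} (A : Arrangement F d n) where
  open OrderedField F
  open Arrangement A using (normal)

  form-combination : ∀ i α β v w → form A i (λ j → α * v j + β * w j) ≡ α * form A i v + β * form A i w
  form-combination i α β v w = begin
    sumF F (λ j → normal i j * u j)             ≡⟨ sumF≡sum (λ j → normal i j * u j) ⟩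
    sum (λ j → normal i j * u j)                ≡⟨ sum-cong-≗ distribute ⟩
    sum (λ j → α * nv j + β * nw j)             ≡⟨ ∑-distrib-+ (λ j → α * nv j) (λ j → β * nw j) ⟩
    sum (λ j → α * nv j) + sum (λ j → β * nw j) ≡⟨ cong₂ _+_ (*-distribˡ-sum α nv) (*-distribˡ-sum β nw) ⟨
    α * sum nv + β * sum nw                     ≡⟨ cong₂ (λ s t → α * s + β * t) (sumF≡sum nv) (sumF≡sum nw) ⟨
    α * form A i v + β * form A i w             ∎
    where
    open ≡-Reasoning
    u nv nw : Fin d → Carrier
    u j = α * v j + β * w j
    nv j = normal i j * v j
    nw j = normal i j * w j
    distribute : ∀ j → normal i j * u j ≡ α * nv j + β * nw j
    distribute j = trans (distribˡ (normal i j) _ _)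
                         (cong₂ _+_ (x∙yz≈y∙xz (normal i j) α (v j)) (x∙yz≈y∙xz (normal i j) β (w j)))

  record Cell (Z : List (Fin n)) (σ : Vec Bool n) : Set where
    constructor cell
    field
      point : Fin d → Carrier
      on    : ∀ {i} → i ∈ Z → form A i point ≡ 0#
      off   : ∀ {i} → i ∉ Z → Sign (lookup σ i) (form A i point)

  chamber⇒cell : ∀ {σ} → IsChamber A σ → Cell [] σ
  chamber⇒cell (v , signs) = cell v (λ ()) (λ {i} _ → signs i)

  cell-resp-↭ : ∀ {Z Z′ σ} → Z ↭ Z′ → Cell Z σ → Cell Z′ σ
  cell-resp-↭ Z↭Z′ (cell v on off) = cell v (on ∘ PermP.∈-resp-↭ (↭-sym Z↭Z′)) (off ∘ (_∘ PermP.∈-resp-↭ Z↭Z′))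

  eliminate : ∀ {h Z σ} → h ∉ Z → Cell Z σ → Cell Z (flip σ h) → Cell (h ∷ Z) σ
  eliminate {h} {Z} {σ} h∉Z (cell v on-v off-v) (cell w on-w off-w)
    with opposite-signs-cancel (lookup σ h) (off-v h∉Z)
                               (subst (λ b → Sign b (form A h w)) (lookup-flip σ h) (off-w h∉Z))
  ... | α , β , 0<α , 0<β , αp+βq≡0 = cell u on-u off-u
    where
    u = λ j → α * v j + β * w j
    on-u : ∀ {i} → i ∈ h ∷ Z → form A i u ≡ 0#
    on-u {i} (here refl) = trans (form-combination i α β v w) αp+βq≡0
    on-u {i} (there i∈Z) = trans (form-combination i α β v w)
      (trans (cong₂ (λ p q → α * p + β * q) (on-v i∈Z) (on-w i∈Z))
             (trans (cong₂ _+_ (zeroʳ α) (zeroʳ β)) (+-identityʳ 0#)))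
    off-u : ∀ {i} → i ∉ h ∷ Z → Sign (lookup σ i) (form A i u)
    off-u {i} i∉h∷Z = subst (Sign (lookup σ i)) (sym (form-combination i α β v w))
      (positive-combination (lookup σ i) 0<α 0<β (off-v (i∉h∷Z ∘ there))
        (subst (λ b → Sign b (form A i w)) (lookup-flip-≢ σ (i∉h∷Z ∘ here)) (off-w (i∉h∷Z ∘ there))))

  eliminate-cube : ∀ {h Z} → h ∉ Z → ∀ L σ → Cube (Cell Z) σ L → Cube (Cell Z) (flip σ h) L → Cube (Cell (h ∷ Z)) σ L
  eliminate-cube h∉Z []      σ C C′ = eliminate h∉Z C C′
  eliminate-cube {h} {Z} h∉Z (g ∷ L) σ (C₀ , C₁) (D₀ , D₁) =
    eliminate-cube h∉Z L σ C₀ D₀ ,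
    eliminate-cube h∉Z L (flip σ g) C₁ (subst (λ τ → Cube (Cell Z) τ L) (flip-comm σ h g) D₁)

  eliminate-all : ∀ {L Z σ} → Unique L → All (_∉ Z) L → Cube (Cell Z) σ L → Cell (L ++ Z) σ
  eliminate-all {[]}    []               []          C         = C
  eliminate-all {h ∷ L} {Z} (h∉L ∷ L-unique) (h∉Z ∷ L∉Z) (C₀ , C₁) =
    cell-resp-↭ (PermP.shift h L Z) (eliminate-all L-unique L∉h∷Z (eliminate-cube h∉Z L _ C₀ C₁))
    where
    L∉h∷Z : All (_∉ h ∷ Z) L
    L∉h∷Z = All.zipWith (λ { (h≢g , g∉Z) → λ { (here g≡h) → h≢g (sym g≡h) ; (there g∈Z) → g∉Z g∈Z } }) (h∉L , L∉Z)

  -- With v in the chamber whose signs are those of c, every term of Σ cᵢ·formᵢ(v) = Σₖ (Σᵢ cᵢ·normalᵢₖ)·vₖ = 0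
  -- is nonnegative, and the i-th is positive unless cᵢ = 0.
  all-chambers⇒Boolean : (∀ τ → IsChamber A τ) → Boolean A
  all-chambers⇒Boolean chamber c c·normal≡0 i with c i ≟ 0#
  ... | yes cᵢ≡0 = cᵢ≡0
  ... | no cᵢ≢0  =
    contradiction (subst (0# <_) total≡0
                         (sumF-pos t (λ j → same-sign⇒*-nonneg (signs j)) i (same-sign⇒*-pos (signs i) cᵢ≢0)))
                  <-irrefl
    where
    signs-of-c = tabulate (positive? ∘ c)
    v = proj₁ (chamber signs-of-c)
    signs : ∀ j → Sign (positive? (c j)) (form A j v)
    signs j = subst (λ b → Sign b (form A j v)) (VecP.lookup∘tabulate _ j) (proj₂ (chamber signs-of-c) j)
    t : Fin n → Carrier
    t j = c j * form A j v
    total≡0 : sumF F t ≡ 0#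
    total≡0 = begin
      sumF F t                                          ≡⟨ sumF≡sum t ⟩
      sum (λ j → c j * sumF F (λ k → normal j k * v k)) ≡⟨ sum-cong-≗ (λ j → cong (c j *_) (sumF≡sum (nv j))) ⟩
      sum (λ j → c j * sum (λ k → normal j k * v k))    ≡⟨ sum-cong-≗ (λ j → *-distribˡ-sum (c j) (nv j)) ⟩
      sum (λ j → sum (λ k → c j * (normal j k * v k)))  ≡⟨ ∑-comm (λ j k → c j * (normal j k * v k)) ⟩
      sum (λ k → sum (λ j → c j * (normal j k * v k)))  ≡⟨ sum-cong-≗ regroup ⟩
      sum (λ k → sum (λ j → c j * normal j k) * v k)    ≡⟨ sum-cong-≗ (λ k → cong (_* v k) (c·normal≡0′ k)) ⟩
      sum (λ k → 0# * v k)                              ≡⟨ sum-cong-≗ {d} (λ k → zeroˡ (v k)) ⟩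
      sum {d} (λ _ → 0#)                                ≡⟨ sum-replicate-zero d ⟩
      0#                                                ∎
      where
      open ≡-Reasoning
      nv : Fin n → Fin d → Carrier
      nv j k = normal j k * v k
      regroup : ∀ k → sum (λ j → c j * (normal j k * v k)) ≡ sum (λ j → c j * normal j k) * v k
      regroup k = trans (sum-cong-≗ (λ j → sym (*-assoc (c j) (normal j k) (v k))))
                        (sym (*-distribʳ-sum (v k) (λ j → c j * normal j k)))
      c·normal≡0′ : ∀ k → sum (λ j → c j * normal j k) ≡ 0#
      c·normal≡0′ k = trans (sym (sumF≡sum (λ j → c j * normal j k))) (c·normal≡0 k)

-- Cycles on the diagonal

tight-split : ∀ {p q k} → 1 ℕ.≤ p → k ℕ.≤ q → p ℕ.+ q ≡ suc k → p ≡ 1 × q ≡ k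
tight-split {suc p′} {q} _ k≤q p+q≡1+k
  with ℕP.n≤0⇒n≡0 (ℕP.+-cancelʳ-≤ q p′ 0 (subst (ℕ._≤ q) (sym (ℕP.suc-injective p+q≡1+k)) k≤q))
... | refl = refl , ℕP.suc-injective p+q≡1+k

module _ {F : RealField} {d n : ℕ} (A : Arrangement F d n) where
  open import Data.Integer using (_+_; _*_)
  open import Data.List.Membership.DecPropositional (FinP._≟_ {n}) using (_∈?_)
  open OrderedField F using (0#; Sign; ¬Sign-0)

  dist≥1 : ∀ {σ τ} → σ ≢ τ → 1 ℕ.≤ dist A σ τ
  dist≥1 {σ} {τ} σ≢τ with dist A σ τ in eq
  ... | zero  = contradiction (hamming≡0⇒≡ (trans (sym (dist≡hamming A σ τ)) eq)) σ≢τ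
  ... | suc _ = ℕ.s≤s ℕ.z≤n

  steps≤weight : ∀ {k} x → Proper A x → length x ≡ suc k → k ℕ.≤ weight A x
  steps≤weight (a ∷ [])    _              refl = ℕ.z≤n
  steps≤weight (a ∷ b ∷ r) (a≢b , proper) refl = ℕP.+-mono-≤ (dist≥1 a≢b) (steps≤weight (b ∷ r) proper refl)

  diagonal⇒gallery : ∀ {k} x → Proper A x → length x ≡ suc k → weight A x ≡ k → ∃₂ λ σ w → x ≡ gallery σ w
  diagonal⇒gallery (a ∷ []) _ _ _ = a , [] , refl
  diagonal⇒gallery {suc k} (a ∷ b ∷ r) (a≢b , proper) len wt
    with tight-split (dist≥1 a≢b) (steps≤weight (b ∷ r) proper (ℕP.suc-injective len)) wt
  ... | step≡1 , rest≡k
    with diagonal⇒gallery (b ∷ r) proper (ℕP.suc-injective len) rest≡k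
       | hamming≡1⇒flip {σ = a} {b} (trans (sym (dist≡hamming A a b)) step≡1)
  ... | .b , w , refl | i , refl = a , i ∷ w , refl

  separating⇒letter : ∀ σ w {i} → InS A (gallery σ w) i → i ∈ w
  separating⇒letter σ (h ∷ w) {i} (inj₁ separates) with i FinP.≟ h
  ... | yes i≡h = here i≡h
  ... | no i≢h  = contradiction (sym (lookup-flip-≢ σ i≢h)) separates
  separating⇒letter σ (h ∷ w) (inj₂ later) = there (separating⇒letter (flip σ h) w later)

  module _ {ℓ : ℕ} (c : FSum A) (c∈MC : InMC A ℓ ℓ c) (cycle : ∀ y → coeff A (∂ A c) y ≡ + 0) where

    Supported : Chain A → Set
    Supported y = coeff A c y ≢ + 0

    supported⇒Gen : ∀ {y} → Supported y → Gen A ℓ ℓ y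
    supported⇒Gen {y} y∈c with All.lookupAny c∈MC (coeff≢0⇒∈ A c y y∈c)
    ... | gen , y≡x = subst (Gen A ℓ ℓ) (sym y≡x) gen

    Gen⇒gallery : ∀ {x} → Gen A ℓ ℓ x → ∃₂ λ σ w → x ≡ gallery σ w
    Gen⇒gallery (len , _ , proper , wt , _) = diagonal⇒gallery _ proper len wt

    coeff-swap : ∀ {h h′} → h ≢ h′ → ∀ b u w →
                 coeff A c (gallery b (u ++ h ∷ h′ ∷ w)) + coeff A c (gallery b (u ++ h′ ∷ h ∷ w)) ≡ + 0
    coeff-swap {h} {h′} h≢h′ b u w with ℤP.i*j≡0⇒i≡0∨j≡0 ε (trans (sym (coeff-∂ A ε boundary c c∈MC)) (cycle Z))
      where
      ε = alternate (+ 1) u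
      Z = shortcut b u h h′ w
      boundary : ∀ {x} → Gen A ℓ ℓ x → coeff A (∂chain A x) Z ≡ ε * δ-pair A x b u h h′ w
      boundary gen with Gen⇒gallery gen
      ... | σ , w′ , refl = begin
        coeff A (∂chain A (gallery σ w′)) Z      ≡⟨ cong (λ f → coeff A f Z) (∂chain≡faces A (gallery σ w′)) ⟩
        coeff A (faces A (+ 1) (gallery σ w′)) Z ≡⟨ cong (λ f → coeff A f Z) (faces-gallery A (+ 1) σ w′) ⟩
        coeff A (galleryFaces (+ 1) σ w′) Z      ≡⟨ coeff-galleryFaces-shortcut A h≢h′ u b w (+ 1) σ w′ ⟩
        ε * δ-pair A (gallery σ w′) b u h h′ w   ∎
        where open ≡-Reasoning
    ... | inj₁ ε≡0   = contradiction (trans (sym (∣alternate∣ (+ 1) u)) (cong ℤ.∣_∣ ε≡0)) λ ()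
    ... | inj₂ sum≡0 = sum≡0

    supported-swap : ∀ {h h′} → h ≢ h′ → ∀ b u w →
                     Supported (gallery b (u ++ h ∷ h′ ∷ w)) → Supported (gallery b (u ++ h′ ∷ h ∷ w))
    supported-swap {h} {h′} h≢h′ b u w supp unsupp =
      supp (trans (sym (ℤP.+-identityʳ X₁)) (trans (cong (λ t → X₁ + t) (sym unsupp)) (coeff-swap h≢h′ b u w)))
      where X₁ = coeff A c (gallery b (u ++ h ∷ h′ ∷ w))

    bring-to-front : ∀ {h} b u w → h ∈ w → Supported (gallery b (u ++ w)) →
                     ∃ λ w′ → Supported (gallery b (u ++ h ∷ w′)) × (∀ {g} → g ∈ w → g ≢ h → g ∈ w′)
    bring-to-front {h} b u (g ∷ w) h∈g∷w supp with g FinP.≟ h | h∈g∷w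
    ... | yes refl | _         = w , supp , λ { (here refl) g≢g → contradiction refl g≢g ; (there g′∈w) _ → g′∈w }
    ... | no g≢h   | here h≡g  = contradiction (sym h≡g) g≢h
    ... | no g≢h   | there h∈w
      with bring-to-front b (u ++ g ∷ []) w h∈w (subst (Supported ∘ gallery b) (sym (ListP.++-assoc u (g ∷ []) w)) supp)
    ...   | w′ , supp′ , keeps =
      g ∷ w′ ,
      supported-swap g≢h b u w′ (subst (Supported ∘ gallery b) (ListP.++-assoc u (g ∷ []) (h ∷ w′)) supp′) ,
      λ { (here refl) _ → here refl ; (there g′∈w) g′≢h → there (keeps g′∈w g′≢h) }

    supported-cube : ∀ {L} → Unique L → ∀ b u w → All (_∈ w) L → Supported (gallery b (u ++ w)) →
                     Cube (IsChamber A) (endpoint b u) L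
    supported-cube [] b u w [] supp = All.lookup (proj₁ (proj₂ (supported⇒Gen supp))) (endpoint-∈ b u w)
    supported-cube {h ∷ L} (h∉L ∷ L-unique) b u w (h∈w ∷ L⊆w) supp with bring-to-front b u w h∈w supp
    ... | w′ , supp′ , keeps =
      supported-cube L-unique b u w L⊆w supp ,
      subst (λ σ → Cube (IsChamber A) σ L) (ListP.foldl-++ flip b u (h ∷ []))
            (supported-cube L-unique b (u ++ h ∷ []) w′ L⊆w′
                            (subst (Supported ∘ gallery b) (sym (ListP.++-assoc u (h ∷ []) w′)) supp′))
      where
      L⊆w′ : All (_∈ w′) L
      L⊆w′ = All.zipWith (λ { (h≢g , g∈w) → keeps g∈w (h≢g ∘ sym) }) (h∉L , L⊆w)

    -- The cell on the crossed hyperplanes lies in ⋂ S(y) = ⋂ A, so no hyperplane can be off it.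
    supported⇒Boolean : ∀ {y} → Supported y → Boolean A
    supported⇒Boolean supp with supported⇒Gen supp
    ... | gen@(_ , _ , _ , _ , interior) with Gen⇒gallery gen
    ...   | σ , w , refl =
      all-chambers⇒Boolean A (λ τ → cube-corner L σ τ cube (λ j j∉L → contradiction (crossed j) j∉L))
      where
      L = deduplicate FinP._≟_ w
      L-unique = UniqueP.deduplicate-! FinP._≟_ w
      cube : Cube (IsChamber A) σ L
      cube = supported-cube L-unique σ [] w (All.tabulate (MemP.∈-deduplicate⁻ FinP._≟_ w)) supp
      crossed-cell : Cell A L σ
      crossed-cell = subst (λ Z → Cell A Z σ) (ListP.++-identityʳ L)
                           (eliminate-all A L-unique (All.tabulate λ _ ()) (cube-map (chamber⇒cell A) L σ cube))
      open Cell crossed-cell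
      vanishes : ∀ i → form A i point ≡ 0#
      vanishes = proj₁ (interior point) (λ i → on ∘ MemP.∈-deduplicate⁺ FinP._≟_ ∘ separating⇒letter σ w)
      crossed : ∀ j → j ∈ L
      crossed j with j ∈? L
      ... | yes j∈L = j∈L
      ... | no j∉L  = contradiction (subst (Sign (lookup σ j)) (vanishes j) (off j∉L)) (¬Sign-0 (lookup σ j))

    diagonal-cycle-vanishes : ¬ Boolean A → ∀ y → coeff A c y ≡ + 0
    diagonal-cycle-vanishes ¬boolean y with coeff A c y ℤP.≟ + 0
    ... | yes c[y]≡0 = c[y]≡0
    ... | no supp    = contradiction (supported⇒Boolean supp) ¬boolean

theorem5p16 : (F : RealField) (d n : ℕ) (A : Arrangement F d n) →
    ¬ Boolean A → ∀ (ℓ : ℕ) → MH°Vanishes A ℓ ℓ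
theorem5p16 F d n A ¬boolean ℓ c c∈MC cycle = [] , [] , λ y → sym (diagonal-cycle-vanishes A c c∈MC cycle ¬boolean y)
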